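{- Let $G$ be a finite graph that is vertex-transitive, twin-free, and has co-twins. If $\{u,v\}$ and $\{x,y\}$ are two distinct pairs of co-twins in $G$, then the subgraph of $G$ induced by $\{u,v,x,y\}$ is $K_2\cup K_2$ (two disjoint edges, each joining a vertex of $\{u,v\}$ to a vertex of $\{x,y\}$).
   Context: $N(u)$ is the open and $N[u]=N(u)\cup\{u\}$ the closed neighborhood of $u$. A graph is twin-free if no two distinct vertices have equal open neighborhoods and no two distinct vertices have equal closed neighborhoods. Co-twins means nonadjacent co-twins: distinct vertices $u,v$ with $N[u]\cap N[v]=\emptyset$ and $N[u]\cup N[v]=V(G)$. In such a graph every vertex has exactly one co-twin, so the vertices are partitioned into co-twin pairs. -}

module Defs where

open import Data.Nat using (ℕ)
open import Data.Fin using (Fin)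
open import Data.Product using (Σ; _×_; ∃)
open import Data.Sum using (_⊎_)
open import Data.Empty using (⊥)
open import Relation.Nullary using (¬_; Dec)
open import Relation.Binary.PropositionalEquality using (_≡_; _≢_)
open import Function.Bundles using (_⇔_; _⤖_; Bijection)

record Graph (n : ℕ) : Set₁ where
  field
    Adj   : Fin n → Fin n → Set
    adj?  : ∀ u v → Dec (Adj u v)
    sym   : ∀ {u v} → Adj u v → Adj v u
    irrefl : ∀ u → ¬ Adj u u

module _ {n : ℕ} (G : Graph n) where
  open Graph G

  InOpen : Fin n → Fin n → Set
  InOpen u w = Adj u w

  InClosed : Fin n → Fin n → Set
  InClosed u w = Adj u w ⊎ w ≡ u

  TwinFree : Set
  TwinFree =
    (∀ u v → (∀ w → InOpen u w ⇔ InOpen v w) → u ≡ v) ×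
    (∀ u v → (∀ w → InClosed u w ⇔ InClosed v w) → u ≡ v)

  CoTwins : Fin n → Fin n → Set
  CoTwins u v =
    u ≢ v ×
    (∀ w → ¬ (InClosed u w × InClosed v w)) ×
    (∀ w → InClosed u w ⊎ InClosed v w)

  HasCoTwins : Set
  HasCoTwins = ∀ u → ∃ λ v → CoTwins u v

  IsAutomorphism : (Fin n → Fin n) → Set
  IsAutomorphism σ =
    (∀ x y → σ x ≡ σ y → x ≡ y) ×
    (∀ y → ∃ λ x → σ x ≡ y) ×
    (∀ u v → Adj u v ⇔ Adj (σ u) (σ v))

  VertexTransitive : Set
  VertexTransitive =
    ∀ a b → ∃ λ (σ : Fin n → Fin n) → IsAutomorphism σ × σ a ≡ b

  SamePair : Fin n → Fin n → Fin n → Fin n → Set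
  SamePair u v x y = (u ≡ x × v ≡ y) ⊎ (u ≡ y × v ≡ x)

  InducedTwoK2 : Fin n → Fin n → Fin n → Fin n → Set
  InducedTwoK2 u v x y =
    (u ≢ v × u ≢ x × u ≢ y × v ≢ x × v ≢ y × x ≢ y) ×
    (¬ Adj u v × ¬ Adj x y) ×
    ((Adj u x × Adj v y × ¬ Adj u y × ¬ Adj v x) ⊎
     (Adj u y × Adj v x × ¬ Adj u x × ¬ Adj v y))

{-# OPTIONS --safe #-}
-- In a twin-free graph a vertex a has at most one co-twin, since every
-- co-twin of a has closed neighbourhood V ∖ N[a]; so two distinct co-twin
-- pairs are disjoint. A vertex outside a co-twin pair {u,v} lies in exactly
-- one of N(u), N(v). Whichever of u, v is adjacent to x is therefore not
-- adjacent to y (x and y share no neighbour), and y must be adjacent to the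
-- other one.
module Submission where

open import Defs
open import Data.Nat using (ℕ)
open import Data.Fin using (Fin)
open import Data.Product using (_,_; _×_)
open import Data.Sum using (inj₁; inj₂; _⊎_; swap)
open import Data.Empty using (⊥-elim)
open import Relation.Nullary using (¬_)
open import Relation.Binary.PropositionalEquality using (_≡_; _≢_; refl; sym)
open import Function.Bundles using (mk⇔)

module _ {n : ℕ} (G : Graph n) where
  open Graph G using (Adj) renaming (sym to Adj-sym)

  CoTwins-sym : ∀ {a b} → CoTwins G a b → CoTwins G b a
  CoTwins-sym (a≢b , disjoint , cover) =
    (λ b≡a → a≢b (sym b≡a)) ,
    (λ w (b∋w , a∋w) → disjoint w (a∋w , b∋w)) ,
    (λ w → swap (cover w))

  CoTwins⇒¬Adj : ∀ {a b} → CoTwins G a b → ¬ Adj a b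
  CoTwins⇒¬Adj (_ , disjoint , _) a~b = disjoint _ (inj₁ a~b , inj₂ refl)

  CoTwins⇒¬Adj-both : ∀ {a b w} → CoTwins G a b → Adj a w → ¬ Adj b w
  CoTwins⇒¬Adj-both (_ , disjoint , _) a~w b~w = disjoint _ (inj₁ a~w , inj₁ b~w)

  CoTwins⇒Adj-either : ∀ {a b w} → CoTwins G a b → a ≢ w → b ≢ w →
                       Adj a w ⊎ Adj b w
  CoTwins⇒Adj-either (_ , _ , cover) a≢w b≢w with cover _
  ... | inj₁ (inj₁ a~w) = inj₁ a~w
  ... | inj₁ (inj₂ w≡a) = ⊥-elim (a≢w (sym w≡a))
  ... | inj₂ (inj₁ b~w) = inj₂ b~w
  ... | inj₂ (inj₂ w≡b) = ⊥-elim (b≢w (sym w≡b))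

  coTwin-closed-⊆ : ∀ {a b c} → CoTwins G a b → CoTwins G a c →
                    ∀ w → InClosed G b w → InClosed G c w
  coTwin-closed-⊆ (_ , disjoint , _) (_ , _ , cover) w b∋w with cover w
  ... | inj₁ a∋w = ⊥-elim (disjoint w (a∋w , b∋w))
  ... | inj₂ c∋w = c∋w

  coTwin-unique : TwinFree G → ∀ {a b c} →
                  CoTwins G a b → CoTwins G a c → b ≡ c
  coTwin-unique (_ , closed-twin-free) {b = b} {c} ab ac =
    closed-twin-free b c λ w →
      mk⇔ (coTwin-closed-⊆ ab ac w) (coTwin-closed-⊆ ac ab w)

  coTwin-pairs-disjoint : TwinFree G → ∀ {u v x y} →
                          CoTwins G u v → CoTwins G x y → ¬ SamePair G u v x y →
                          u ≢ x × u ≢ y × v ≢ x × v ≢ y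
  coTwin-pairs-disjoint tf uv xy ¬same =
    (λ { refl → ¬same (inj₁ (refl , coTwin-unique tf uv xy)) }) ,
    (λ { refl → ¬same (inj₂ (refl , coTwin-unique tf uv (CoTwins-sym xy))) }) ,
    (λ { refl → ¬same (inj₂ (coTwin-unique tf (CoTwins-sym uv) xy , refl)) }) ,
    (λ { refl → ¬same (inj₁ (coTwin-unique tf (CoTwins-sym uv) (CoTwins-sym xy) , refl)) })

  coTwin-pairs-matched : ∀ {u v x y} → CoTwins G u v → CoTwins G x y →
                         u ≢ y → v ≢ y → Adj u x →
                         Adj u x × Adj v y × ¬ Adj u y × ¬ Adj v x
  coTwin-pairs-matched uv xy u≢y v≢y u~x
    with CoTwins⇒Adj-either uv u≢y v≢y
  ... | inj₁ u~y = ⊥-elim (CoTwins⇒¬Adj-both xy (Adj-sym u~x) (Adj-sym u~y))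
  ... | inj₂ v~y =
    u~x , v~y ,
    (λ u~y → CoTwins⇒¬Adj-both xy (Adj-sym u~x) (Adj-sym u~y)) ,
    CoTwins⇒¬Adj-both uv u~x

  coTwin-pairs-matching : ∀ {u v x y} → CoTwins G u v → CoTwins G x y →
                          u ≢ x × u ≢ y × v ≢ x × v ≢ y →
                          (Adj u x × Adj v y × ¬ Adj u y × ¬ Adj v x) ⊎
                          (Adj u y × Adj v x × ¬ Adj u x × ¬ Adj v y)
  coTwin-pairs-matching uv xy (u≢x , u≢y , v≢x , v≢y)
    with CoTwins⇒Adj-either uv u≢x v≢x
  ... | inj₁ u~x = inj₁ (coTwin-pairs-matched uv xy u≢y v≢y u~x)
  ... | inj₂ v~x
    with coTwin-pairs-matched (CoTwins-sym uv) xy v≢y u≢y v~x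
  ...   | _ , u~y , ¬v~y , ¬u~x = inj₂ (u~y , v~x , ¬u~x , ¬v~y)

lemma34 : (n : ℕ) (G : Graph n) →
          VertexTransitive G → TwinFree G → HasCoTwins G →
          (u v x y : Fin n) →
          CoTwins G u v → CoTwins G x y → ¬ SamePair G u v x y →
          InducedTwoK2 G u v x y
lemma34 n G _ tf _ u v x y uv@(u≢v , _) xy@(x≢y , _) ¬same
  with coTwin-pairs-disjoint G tf uv xy ¬same
... | distinct@(u≢x , u≢y , v≢x , v≢y) =
  (u≢v , u≢x , u≢y , v≢x , v≢y , x≢y) ,
  (CoTwins⇒¬Adj G uv , CoTwins⇒¬Adj G xy) ,
  coTwin-pairs-matching G uv xy distinct
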